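{- The rules of mix, exchange, duplication, contraction, conservative $\vee$-introduction and conservative $\wedge$-introduction preserve truth in the bottom-up direction: for every classical model $M$ and every application of one of these rules, if the conclusion is true in $M$ then so is each premise.
   Context: Formulas: built from propositional atoms using $\neg,\wedge,\vee$ (binary), with $\neg$ only on atoms. A $k$-ary cirquent is a pair of a structure, i.e. a finite sequence (repetitions allowed) of subsets of $\{1,\dots,k\}$ (ogroups), and a pool $\langle F_1,\dots,F_k\rangle$ of formulas (oformulas); ogroup $\Gamma$ contains $F_i$ for $i\in\Gamma$. Rules: Mix: from $(\langle\Gamma_1..\Gamma_m\rangle,\langle F_1..F_k\rangle)$ and $(\langle\Delta_1..\Delta_n\rangle,\langle G_1..G_l\rangle)$ infer $(\langle\Gamma_1,..,\Gamma_m,\Delta_1+k,..,\Delta_n+k\rangle,\langle F_1,..,F_k,G_1,..,G_l\rangle)$, $\Delta+k=\{j+k:j\in\Delta\}$. Exchange: swap two adjacent oformulas (each ogroup keeping the same oformulas) or swap two adjacent ogroups. Duplication: replace an ogroup $\Gamma$ by adjacent $\Gamma,\Gamma$, or the reverse. Contraction: merge two adjacent oformulas that are the same formula $F$ into one oformula $F$, each ogroup containing either of them now containing the merged one. $\vee$-introduction: merge adjacent oformulas $F,G$ into one oformula $F\vee G$, contained in exactly those ogroups that contained $F$ or $G$. It is conservative if every ogroup of the premise containing $F$ or $G$ contains both. $\wedge$-introduction: when for adjacent oformulas $F,G$ no ogroup contains both, every ogroup containing $F$ is immediately followed by an ogroup containing $G$, and every ogroup containing $G$ is immediately preceded by an ogroup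 containing $F$: replace each such pair of adjacent ogroups by their union, then merge $F,G$ into a single oformula $F\wedge G$ (contained in exactly the ogroups that contained $F$ or $G$). It is conservative if, for every such merged pair $\Gamma$ (containing $F$) and $\Delta$ (containing $G$), the oformulas of $\Gamma$ other than $F$ are exactly the oformulas of $\Delta$ other than $G$. A classical model assigns a truth value to each atom, extended to formulas classically. A group is true in $M$ iff at least one of its oformulas is; a cirquent is true in $M$ iff all its groups are. -}

module Defs where

open import Data.Nat using (ℕ; suc; _+_)
open import Data.Bool using (Bool; true; false; _∧_; _∨_; not)
open import Data.Vec using (Vec; []; _∷_; _++_; lookup; replicate; zipWith)
open import Data.Fin using (Fin)
open import Data.Unit using (⊤)
open import Data.List using (List; []; _∷_; map; concatMap) renaming (_++_ to _++ₗ_)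
open import Data.List.Relation.Unary.All using (All)
open import Data.Product using (Σ; _×_; _,_)
open import Relation.Binary.PropositionalEquality using (_≡_)

data Formula : Set where
  atom  : ℕ → Formula
  natom : ℕ → Formula
  _∧ᶠ_  : Formula → Formula → Formula
  _∨ᶠ_  : Formula → Formula → Formula

-- An ogroup of a k-ary cirquent: a subset of {1..k}, as a characteristic vector.
Ogroup : ℕ → Set
Ogroup k = Vec Bool k

record Cirquent : Set where
  constructor cirq
  field
    arity  : ℕ
    struct : List (Ogroup arity)
    pool   : Vec Formula arity
open Cirquent public

Model : Set
Model = ℕ → Bool

eval : Model → Formula → Bool
eval M (atom n)  = M n
eval M (natom n) = not (M n)
eval M (F ∧ᶠ G)  = eval M F ∧ eval M G
eval M (F ∨ᶠ G)  = eval M F ∨ eval M G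

GroupTrue : Model → {k : ℕ} → Vec Formula k → Ogroup k → Set
GroupTrue M {k} P Γ = Σ (Fin k) λ i → (lookup Γ i ≡ true) × (eval M (lookup P i) ≡ true)

CirqTrue : Model → Cirquent → Set
CirqTrue M (cirq k S P) = All (GroupTrue M P) S

-- An ogroup of arity a + 2 + b, split around two adjacent positions a+1, a+2:
-- (membership on the first a positions, membership of position a+1,
--  membership of position a+2, membership on the last b positions).
Split : ℕ → ℕ → Set
Split a b = Vec Bool a × Bool × Bool × Vec Bool b

join2 : ∀ {a b} → Split a b → Ogroup (a + suc (suc b))
join2 (u , p , q , v) = u ++ (p ∷ q ∷ v)

swap2 : ∀ {a b} → Split a b → Ogroup (a + suc (suc b))
swap2 (u , p , q , v) = u ++ (q ∷ p ∷ v)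

merge2 : ∀ {a b} → Split a b → Ogroup (a + suc b)
merge2 (u , p , q , v) = u ++ ((p ∨ q) ∷ v)

Conservative∨ : ∀ {a b} → Split a b → Set
Conservative∨ (u , p , q , v) = p ≡ q

-- Structures admissible for ∧-introduction on positions a+1 (F), a+2 (G):
-- by the side conditions (no ogroup contains both; every ogroup containing F
-- is immediately followed by one containing G and every ogroup containing G
-- is immediately preceded by one containing F) the premise structure is
-- uniquely a sequence of items: a single ogroup containing neither F nor G,
-- or an adjacent pair (ogroup with F and not G, ogroup with G and not F).
data ∧Item (a b : ℕ) : Set where
  single : Vec Bool a → Vec Bool b → ∧Item a b
  pair   : Vec Bool a → Vec Bool b → Vec Bool a → Vec Bool b → ∧Item a b

∧premise : ∀ {a b} → ∧Item a b → List (Ogroup (a + suc (suc b)))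
∧premise (single u v)       = (u ++ (false ∷ false ∷ v)) ∷ []
∧premise (pair u₁ v₁ u₂ v₂) = (u₁ ++ (true ∷ false ∷ v₁)) ∷ (u₂ ++ (false ∷ true ∷ v₂)) ∷ []

∧conclusion : ∀ {a b} → ∧Item a b → Ogroup (a + suc b)
∧conclusion (single u v)       = u ++ (false ∷ v)
∧conclusion (pair u₁ v₁ u₂ v₂) = zipWith _∨_ u₁ u₂ ++ (true ∷ zipWith _∨_ v₁ v₂)

Conservative∧ : ∀ {a b} → ∧Item a b → Set
Conservative∧ (single u v)       = ⊤
Conservative∧ (pair u₁ v₁ u₂ v₂) = (u₁ ≡ u₂) × (v₁ ≡ v₂)

data Rule : List Cirquent → Cirquent → Set where
  mix : ∀ {k l} (Γs : List (Ogroup k)) (Fs : Vec Formula k)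
          (Δs : List (Ogroup l)) (Gs : Vec Formula l) →
        Rule (cirq k Γs Fs ∷ cirq l Δs Gs ∷ [])
             (cirq (k + l) (map (λ Γ → Γ ++ replicate l false) Γs
                           ++ₗ map (λ Δ → replicate k false ++ Δ) Δs)
                           (Fs ++ Gs))
  exch-oformula : ∀ {a b} (gs : List (Split a b)) (xs : Vec Formula a) (F G : Formula)
                    (ys : Vec Formula b) →
        Rule (cirq _ (map join2 gs) (xs ++ (F ∷ G ∷ ys)) ∷ [])
             (cirq _ (map swap2 gs) (xs ++ (G ∷ F ∷ ys)))
  exch-ogroup : ∀ {k} (Γs : List (Ogroup k)) (Γ Δ : Ogroup k) (Δs : List (Ogroup k))
                  (P : Vec Formula k) →
        Rule (cirq k (Γs ++ₗ (Γ ∷ Δ ∷ Δs)) P ∷ [])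
             (cirq k (Γs ++ₗ (Δ ∷ Γ ∷ Δs)) P)
  dup : ∀ {k} (Γs : List (Ogroup k)) (Γ : Ogroup k) (Δs : List (Ogroup k))
          (P : Vec Formula k) →
        Rule (cirq k (Γs ++ₗ (Γ ∷ Δs)) P ∷ [])
             (cirq k (Γs ++ₗ (Γ ∷ Γ ∷ Δs)) P)
  undup : ∀ {k} (Γs : List (Ogroup k)) (Γ : Ogroup k) (Δs : List (Ogroup k))
            (P : Vec Formula k) →
        Rule (cirq k (Γs ++ₗ (Γ ∷ Γ ∷ Δs)) P ∷ [])
             (cirq k (Γs ++ₗ (Γ ∷ Δs)) P)
  contr : ∀ {a b} (gs : List (Split a b)) (xs : Vec Formula a) (F : Formula)
            (ys : Vec Formula b) →
        Rule (cirq _ (map join2 gs) (xs ++ (F ∷ F ∷ ys)) ∷ [])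
             (cirq _ (map merge2 gs) (xs ++ (F ∷ ys)))
  cons-∨ : ∀ {a b} (gs : List (Split a b)) (xs : Vec Formula a) (F G : Formula)
             (ys : Vec Formula b) →
        All Conservative∨ gs →
        Rule (cirq _ (map join2 gs) (xs ++ (F ∷ G ∷ ys)) ∷ [])
             (cirq _ (map merge2 gs) (xs ++ ((F ∨ᶠ G) ∷ ys)))
  cons-∧ : ∀ {a b} (is : List (∧Item a b)) (xs : Vec Formula a) (F G : Formula)
             (ys : Vec Formula b) →
        All Conservative∧ is →
        Rule (cirq _ (concatMap ∧premise is) (xs ++ (F ∷ G ∷ ys)) ∷ [])
             (cirq _ (map ∧conclusion is) (xs ++ ((F ∧ᶠ G) ∷ ys)))

{-# OPTIONS --safe #-}
module Submission where

-- Mix, exchange of ogroups and (un)duplication only pad or rearrange the groups of the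
-- premises. The other rules change the pool only inside a window of adjacent positions,
-- so the true oformula witnessing a group of the conclusion either lies outside the
-- window, where it witnesses the premise group too, or must be pushed back through it.
-- Conservativity is what makes the latter possible: a true F ∨ G lies in a group that
-- contains both F and G, and a true F ∧ G in a merged pair makes F true in one half and
-- G true in the other, each half having the other oformulas of the merged group.

open import Defs
open import Data.Bool using (Bool; true; false; _∧_; _∨_)
open import Data.Bool.Properties using (∨-idem)
open import Data.Empty using (⊥; ⊥-elim)
open import Data.Fin using (zero; suc)
open import Data.List using (List; []; _∷_; map) renaming (_++_ to _++ₗ_)
open import Data.List.Relation.Unary.All using (All; []; _∷_; zipWith)
open import Data.List.Relation.Unary.All.Properties using (++⁺; ++⁻; map⁺; map⁻; gmap⁻; concat⁺)
open import Data.Product using (_×_; _,_; proj₁; proj₂)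
open import Data.Sum using (_⊎_; inj₁; inj₂)
open import Data.Vec using (Vec; []; _∷_; _++_; replicate)
open import Data.Vec.Properties using (zipWith-idem)
open import Relation.Binary.PropositionalEquality using (_≡_; refl; subst; cong₂)

∨-true⁻ : ∀ {x y} → x ∨ y ≡ true → x ≡ true ⊎ y ≡ true
∨-true⁻ {true}  _ = inj₁ refl
∨-true⁻ {false} y = inj₂ y

∧-true⁻ : ∀ {x y} → x ∧ y ≡ true → x ≡ true × y ≡ true
∧-true⁻ {true} y = refl , y

module _ (M : Model) where

  GroupTrue-++⁺ˡ : ∀ {a n} (xs : Vec Formula a) (u : Vec Bool a) {P : Vec Formula n} {Q : Vec Bool n} →
                   GroupTrue M xs u → GroupTrue M (xs ++ P) (u ++ Q)
  GroupTrue-++⁺ˡ (_ ∷ _)  (_ ∷ _) (zero , γ , F)  = zero , γ , F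
  GroupTrue-++⁺ˡ (_ ∷ xs) (_ ∷ u) (suc i , γ , F) with GroupTrue-++⁺ˡ xs u (i , γ , F)
  ... | j , γ′ , F′ = suc j , γ′ , F′

  GroupTrue-++⁺ʳ : ∀ {a n} (xs : Vec Formula a) (u : Vec Bool a) {P : Vec Formula n} {Q : Vec Bool n} →
                   GroupTrue M P Q → GroupTrue M (xs ++ P) (u ++ Q)
  GroupTrue-++⁺ʳ []       []      g = g
  GroupTrue-++⁺ʳ (_ ∷ xs) (_ ∷ u) g with GroupTrue-++⁺ʳ xs u g
  ... | j , γ , F = suc j , γ , F

  GroupTrue-++⁻ : ∀ {a n} (xs : Vec Formula a) (u : Vec Bool a) {P : Vec Formula n} {Q : Vec Bool n} →
                  GroupTrue M (xs ++ P) (u ++ Q) → GroupTrue M xs u ⊎ GroupTrue M P Q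
  GroupTrue-++⁻ []       []      g               = inj₂ g
  GroupTrue-++⁻ (_ ∷ _)  (_ ∷ _) (zero , γ , F)  = inj₁ (zero , γ , F)
  GroupTrue-++⁻ (_ ∷ xs) (_ ∷ u) (suc i , γ , F) with GroupTrue-++⁻ xs u (i , γ , F)
  ... | inj₁ (j , γ′ , F′) = inj₁ (suc j , γ′ , F′)
  ... | inj₂ g             = inj₂ g

  ¬GroupTrue-replicate-false : ∀ {n} (P : Vec Formula n) → GroupTrue M P (replicate n false) → ⊥
  ¬GroupTrue-replicate-false (_ ∷ _) (zero , () , _)
  ¬GroupTrue-replicate-false (_ ∷ P) (suc i , γ , F) = ¬GroupTrue-replicate-false P (i , γ , F)

  GroupTrue-padʳ⁻ : ∀ {k l} (Fs : Vec Formula k) (Gs : Vec Formula l) (Γ : Vec Bool k) →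
                    GroupTrue M (Fs ++ Gs) (Γ ++ replicate l false) → GroupTrue M Fs Γ
  GroupTrue-padʳ⁻ Fs Gs Γ g with GroupTrue-++⁻ Fs Γ g
  ... | inj₁ g-Fs = g-Fs
  ... | inj₂ g-Gs = ⊥-elim (¬GroupTrue-replicate-false Gs g-Gs)

  GroupTrue-padˡ⁻ : ∀ {k l} (Fs : Vec Formula k) (Gs : Vec Formula l) (Δ : Vec Bool l) →
                    GroupTrue M (Fs ++ Gs) (replicate k false ++ Δ) → GroupTrue M Gs Δ
  GroupTrue-padˡ⁻ Fs Gs Δ g with GroupTrue-++⁻ Fs (replicate _ false) g
  ... | inj₁ g-Fs = ⊥-elim (¬GroupTrue-replicate-false Fs g-Fs)
  ... | inj₂ g-Gs = g-Gs

  GroupTrue-prefixed : ∀ {a m n} (xs : Vec Formula a) (u : Vec Bool a)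
                       {P : Vec Formula m} {Q : Vec Bool m} {P′ : Vec Formula n} {Q′ : Vec Bool n} →
                       (GroupTrue M P′ Q′ → GroupTrue M P Q) →
                       GroupTrue M (xs ++ P′) (u ++ Q′) → GroupTrue M (xs ++ P) (u ++ Q)
  GroupTrue-prefixed xs u suffix g with GroupTrue-++⁻ xs u g
  ... | inj₁ g-xs = GroupTrue-++⁺ˡ xs u g-xs
  ... | inj₂ g-P′ = GroupTrue-++⁺ʳ xs u (suffix g-P′)

  exchange-suffix : ∀ {n F G p q} {ys : Vec Formula n} {v} →
                    GroupTrue M (G ∷ F ∷ ys) (q ∷ p ∷ v) → GroupTrue M (F ∷ G ∷ ys) (p ∷ q ∷ v)
  exchange-suffix (zero , γ)        = suc zero , γ
  exchange-suffix (suc zero , γ)    = zero , γ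
  exchange-suffix (suc (suc i) , γ) = suc (suc i) , γ

  contraction-suffix : ∀ {n F p q} {ys : Vec Formula n} {v} →
                       GroupTrue M (F ∷ ys) ((p ∨ q) ∷ v) → GroupTrue M (F ∷ F ∷ ys) (p ∷ q ∷ v)
  contraction-suffix (zero , p∨q , F) with ∨-true⁻ p∨q
  ... | inj₁ p = zero , p , F
  ... | inj₂ q = suc zero , q , F
  contraction-suffix (suc i , γ) = suc (suc i) , γ

  ∨-suffix : ∀ {n F G p} {ys : Vec Formula n} {v} →
             GroupTrue M (F ∨ᶠ G ∷ ys) ((p ∨ p) ∷ v) → GroupTrue M (F ∷ G ∷ ys) (p ∷ p ∷ v)
  ∨-suffix {p = true} (zero , _ , F∨G) with ∨-true⁻ F∨G
  ... | inj₁ F = zero , refl , F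
  ... | inj₂ G = suc zero , refl , G
  ∨-suffix (suc i , γ) = suc (suc i) , γ

  ∧-suffix-neither : ∀ {n F G} {ys : Vec Formula n} {v} →
                     GroupTrue M (F ∧ᶠ G ∷ ys) (false ∷ v) → GroupTrue M (F ∷ G ∷ ys) (false ∷ false ∷ v)
  ∧-suffix-neither (suc i , γ) = suc (suc i) , γ

  ∧-suffixˡ : ∀ {n F G} {ys : Vec Formula n} {v} →
              GroupTrue M (F ∧ᶠ G ∷ ys) (true ∷ v) → GroupTrue M (F ∷ G ∷ ys) (true ∷ false ∷ v)
  ∧-suffixˡ (zero , _ , F∧G) = zero , refl , proj₁ (∧-true⁻ F∧G)
  ∧-suffixˡ (suc i , γ)      = suc (suc i) , γ

  ∧-suffixʳ : ∀ {n F G} {ys : Vec Formula n} {v} →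
              GroupTrue M (F ∧ᶠ G ∷ ys) (true ∷ v) → GroupTrue M (F ∷ G ∷ ys) (false ∷ true ∷ v)
  ∧-suffixʳ (zero , _ , F∧G) = suc zero , refl , proj₂ (∧-true⁻ F∧G)
  ∧-suffixʳ (suc i , γ)      = suc (suc i) , γ

  exchange-sound : ∀ {a b} (xs : Vec Formula a) {F G} {ys : Vec Formula b} (g : Split a b) →
                   GroupTrue M (xs ++ (G ∷ F ∷ ys)) (swap2 g) → GroupTrue M (xs ++ (F ∷ G ∷ ys)) (join2 g)
  exchange-sound xs (u , _) = GroupTrue-prefixed xs u exchange-suffix

  contraction-sound : ∀ {a b} (xs : Vec Formula a) {F} {ys : Vec Formula b} (g : Split a b) →
                      GroupTrue M (xs ++ (F ∷ ys)) (merge2 g) → GroupTrue M (xs ++ (F ∷ F ∷ ys)) (join2 g)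
  contraction-sound xs (u , _) = GroupTrue-prefixed xs u contraction-suffix

  ∨-sound : ∀ {a b} (xs : Vec Formula a) {F G} {ys : Vec Formula b} (g : Split a b) → Conservative∨ g →
            GroupTrue M (xs ++ (F ∨ᶠ G ∷ ys)) (merge2 g) → GroupTrue M (xs ++ (F ∷ G ∷ ys)) (join2 g)
  ∨-sound xs (u , _) refl = GroupTrue-prefixed xs u ∨-suffix

  ∧-sound : ∀ {a b} (xs : Vec Formula a) {F G} {ys : Vec Formula b} (it : ∧Item a b) → Conservative∧ it →
            GroupTrue M (xs ++ (F ∧ᶠ G ∷ ys)) (∧conclusion it) → All (GroupTrue M (xs ++ (F ∷ G ∷ ys))) (∧premise it)
  ∧-sound xs (single u v) _ g = GroupTrue-prefixed xs u ∧-suffix-neither g ∷ []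
  ∧-sound xs {F} {G} {ys} (pair u v .u .v) (refl , refl) g =
    GroupTrue-prefixed xs u ∧-suffixˡ g′ ∷ GroupTrue-prefixed xs u ∧-suffixʳ g′ ∷ []
    where
    g′ : GroupTrue M (xs ++ (F ∧ᶠ G ∷ ys)) (u ++ (true ∷ v))
    g′ = subst (GroupTrue M (xs ++ (F ∧ᶠ G ∷ ys)))
               (cong₂ (λ u v → u ++ (true ∷ v)) (zipWith-idem ∨-idem u) (zipWith-idem ∨-idem v)) g

  mix-sound : ∀ {k l} (Fs : Vec Formula k) (Gs : Vec Formula l) (Γs : List (Ogroup k)) {Δs : List (Ogroup l)} →
              All (GroupTrue M (Fs ++ Gs)) (map (_++ replicate l false) Γs ++ₗ map (replicate k false ++_) Δs) →
              All (GroupTrue M Fs) Γs × All (GroupTrue M Gs) Δs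
  mix-sound Fs Gs Γs h with ++⁻ (map _ Γs) h
  ... | hΓ , hΔ = gmap⁻ (λ {Γ} → GroupTrue-padʳ⁻ Fs Gs Γ) hΓ , gmap⁻ (λ {Δ} → GroupTrue-padˡ⁻ Fs Gs Δ) hΔ

lemma6p2 : (M : Model) (ps : List Cirquent) (c : Cirquent) →
           Rule ps c → CirqTrue M c → All (CirqTrue M) ps
lemma6p2 M _ _ (mix Γs Fs _ Gs) h with mix-sound M Fs Gs Γs h
... | hΓ , hΔ = hΓ ∷ hΔ ∷ []
lemma6p2 M _ _ (exch-oformula _ xs _ _ _) h = map⁺ (gmap⁻ (λ {g} → exchange-sound M xs g) h) ∷ []
lemma6p2 M _ _ (exch-ogroup Γs _ _ _ _) h with ++⁻ Γs h
... | before , δ ∷ γ ∷ after = ++⁺ before (γ ∷ δ ∷ after) ∷ []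
lemma6p2 M _ _ (dup Γs _ _ _) h with ++⁻ Γs h
... | before , γ ∷ _ ∷ after = ++⁺ before (γ ∷ after) ∷ []
lemma6p2 M _ _ (undup Γs _ _ _) h with ++⁻ Γs h
... | before , γ ∷ after = ++⁺ before (γ ∷ γ ∷ after) ∷ []
lemma6p2 M _ _ (contr _ xs _ _) h = map⁺ (gmap⁻ (λ {g} → contraction-sound M xs g) h) ∷ []
lemma6p2 M _ _ (cons-∨ _ xs _ _ _ cs) h = map⁺ (zipWith (λ {g} (c , t) → ∨-sound M xs g c t) (cs , map⁻ h)) ∷ []
lemma6p2 M _ _ (cons-∧ _ xs _ _ _ cs) h = concat⁺ (map⁺ (zipWith (λ {it} (c , t) → ∧-sound M xs it c t) (cs , map⁻ h))) ∷ []
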